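{- Let $m, n$ be integers with $1 \le m \le n$. Then $$\sum_{(m_1,\dots,m_t)} (-1)^t\binom{n-m_1}{m_1-1}\binom{n-m_2}{m_2}\cdots\binom{n-m_t}{m_t} = (-1)^m C_{m-1},$$ where the sum ranges over all tuples $(m_1,\dots,m_t)$, of any length $t \ge 1$, of positive integers with $m_1 + \dots + m_t = m$, and $C_{k} = \frac{1}{k+1}\binom{2k}{k}$ denotes the $k$-th Catalan number.
   Context: Binomial coefficients $\binom{a}{b}$ with $b > a \ge 0$ or $b<0$ are taken to be $0$. -}

module Defs where

open import Data.Nat as ℕ using (ℕ; zero; suc; _∸_; _≤_)
open import Data.Nat.Combinatorics using (_C_)
open import Data.Nat.DivMod using (_/_)
open import Data.Integer as ℤ using (ℤ; +_; -1ℤ)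
open import Data.List using (List; []; _∷_; length; foldr; map)
open import Data.Nat.ListAction using (sum)
open import Data.List.Relation.Unary.All using (All)
open import Data.Product using (_×_)

sumℤ : List ℤ → ℤ
sumℤ = foldr ℤ._+_ (+ 0)

IsComposition : ℕ → List ℕ → Set
IsComposition m c = (1 ≤ length c) × All (λ x → 1 ≤ x) c × (sum c ≡ m)
  where open import Relation.Binary.PropositionalEquality using (_≡_)

tailProd : ℕ → List ℕ → ℕ
tailProd n []       = 1
tailProd n (x ∷ xs) = ((n ∸ x) C x) ℕ.* tailProd n xs

term : ℕ → List ℕ → ℤ
term n []        = + 0
term n (m₁ ∷ ms) =
  (-1ℤ ℤ.^ length (m₁ ∷ ms)) ℤ.* (+ (((n ∸ m₁) C (m₁ ∸ 1)) ℕ.* tailProd n ms))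

catalan : ℕ → ℕ
catalan k = ((2 ℕ.* k) C k) / suc k

{-# OPTIONS --safe #-}
module Submission where

-- Let z = Σ C_k X^(k+1) and F_n = Σ_k binom(n-k, k) X^k. The Catalan recurrence
-- (k+2) C_(k+1) = 2(2k+1) C_k says (1 - 4X) X z′ = X (1 - 2z), which forces z² = z - X,
-- so g(X) = z(-X) satisfies g² = g + X.
-- Expanding 1/F_n as a geometric series, 1/F_n = Σ_m X^m Σ (-1)^t ∏ binom(n-m_i, m_i)
-- summed over the compositions (m_1, …, m_t) of m; splitting off the first part shows that
-- the sum in the theorem is the coefficient of X^m in -X F_(n-1) / F_n.
-- Pascal's rule gives F_(n+1) = F_n + X F_(n-1), and with g² = g + X this yields
-- g F_(n+1) + X F_n = g^(n+1) (g + X) = O(X^(n+2)). Hence -X F_(n-1) / F_n agrees with g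
-- up to X^n, and the coefficient of X^m in g is (-1)^m C_(m-1).

open import Defs
open import Data.Nat as ℕ using (ℕ; _≤_; _∸_)
open import Data.Integer as ℤ using (ℤ; +_; -1ℤ)
open import Data.List using (List; map)
open import Data.List.Membership.Propositional using (_∈_)
open import Data.List.Relation.Unary.Unique.Propositional using (Unique)
open import Data.Product using (_×_)
open import Function.Bundles using (_⇔_)
open import Relation.Binary.PropositionalEquality using (_≡_)

module CatalanNumbers where
  open import Data.Nat using (zero; suc; _+_; _*_; z≤n; s≤s)
  open import Data.Nat.Properties
  open import Data.Nat.Combinatorics
    using (_C_; nCk+nC[k+1]≡[n+1]C[k+1]; k>n⇒nCk≡0; nC1≡n; nCk≡nC[n∸k])
  open import Data.Nat.DivMod using (_/_; m*n/n≡m)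
  open import Data.Nat.Tactic.RingSolver using (solve-∀)
  open import Algebra.Properties.CommutativeSemigroup *-commutativeSemigroup using (x∙yz≈y∙xz)
  open import Relation.Binary.PropositionalEquality using (refl; sym; trans; cong; cong₂; module ≡-Reasoning)
  open ≡-Reasoning

  [k+1]*[n+1]C[k+1]≡[n+1]*nCk : ∀ n k → suc k * (suc n C suc k) ≡ suc n * (n C k)
  [k+1]*[n+1]C[k+1]≡[n+1]*nCk zero zero = refl
  [k+1]*[n+1]C[k+1]≡[n+1]*nCk zero (suc k) =
    trans (cong (suc (suc k) *_) (k>n⇒nCk≡0 {1} {suc (suc k)} (s≤s (s≤s z≤n)))) (*-zeroʳ (suc (suc k)))
  [k+1]*[n+1]C[k+1]≡[n+1]*nCk (suc n) zero =
    trans (+-identityʳ _) (trans (nC1≡n (suc (suc n))) (sym (*-identityʳ (suc (suc n)))))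
  [k+1]*[n+1]C[k+1]≡[n+1]*nCk (suc n) (suc k) = begin
    suc (suc k) * (suc (suc n) C suc (suc k))
      ≡⟨ cong (suc (suc k) *_) (nCk+nC[k+1]≡[n+1]C[k+1] (suc n) (suc k)) ⟨
    suc (suc k) * (suc n C suc k + suc n C suc (suc k))
      ≡⟨ solve₁ k (suc n C suc k) (suc n C suc (suc k)) ⟩
    (suc k * (suc n C suc k) + suc n C suc k) + suc (suc k) * (suc n C suc (suc k))
      ≡⟨ cong₂ (λ u v → (u + suc n C suc k) + v)
           ([k+1]*[n+1]C[k+1]≡[n+1]*nCk n k) ([k+1]*[n+1]C[k+1]≡[n+1]*nCk n (suc k)) ⟩
    (suc n * (n C k) + suc n C suc k) + suc n * (n C suc k)
      ≡⟨ solve₂ n (n C k) (n C suc k) (suc n C suc k) ⟩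
    suc n * (n C k + n C suc k) + suc n C suc k
      ≡⟨ cong (λ u → suc n * u + suc n C suc k) (nCk+nC[k+1]≡[n+1]C[k+1] n k) ⟩
    suc n * (suc n C suc k) + suc n C suc k
      ≡⟨ solve₃ n (suc n C suc k) ⟩
    suc (suc n) * (suc n C suc k) ∎
    where
    solve₁ : ∀ k a b → suc (suc k) * (a + b) ≡ (suc k * a + a) + suc (suc k) * b
    solve₁ = solve-∀
    solve₂ : ∀ n a b c → (suc n * a + c) + suc n * b ≡ suc n * (a + b) + c
    solve₂ = solve-∀
    solve₃ : ∀ n a → suc n * a + a ≡ suc (suc n) * a
    solve₃ = solve-∀

  2*[1+k]≡2+[k+k] : ∀ k → 2 * suc k ≡ suc (suc (k + k))
  2*[1+k]≡2+[k+k] = solve-∀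

  [1+k+k]C[1+k]≡[1+k+k]Ck : ∀ k → suc (k + k) C suc k ≡ suc (k + k) C k
  [1+k+k]C[1+k]≡[1+k+k]Ck k = begin
    suc (k + k) C suc k               ≡⟨ cong (suc (k + k) C_) [1+k+k]∸k≡1+k ⟨
    suc (k + k) C (suc (k + k) ∸ k)   ≡⟨ nCk≡nC[n∸k] k≤1+k+k ⟨
    suc (k + k) C k                   ∎
    where
    k≤1+k+k : k ≤ suc (k + k)
    k≤1+k+k = ≤-trans (m≤m+n k k) (n≤1+n _)
    [1+k+k]∸k≡1+k : suc (k + k) ∸ k ≡ suc k
    [1+k+k]∸k≡1+k = trans (+-∸-assoc 1 (m≤m+n k k)) (cong suc (m+n∸m≡n k k))

  k*[2k]Ck≡[k+1]*[2k]C[k+1] : ∀ k → k * ((2 * k) C k) ≡ suc k * ((2 * k) C suc k)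
  k*[2k]Ck≡[k+1]*[2k]C[k+1] zero = refl
  k*[2k]Ck≡[k+1]*[2k]C[k+1] (suc k) = begin
    suc k * (2 * suc k C suc k)
      ≡⟨ cong (λ n → suc k * (n C suc k)) (2*[1+k]≡2+[k+k] k) ⟩
    suc k * (suc (suc (k + k)) C suc k)
      ≡⟨ [k+1]*[n+1]C[k+1]≡[n+1]*nCk (suc (k + k)) k ⟩
    suc (suc (k + k)) * (suc (k + k) C k)
      ≡⟨ cong (suc (suc (k + k)) *_) ([1+k+k]C[1+k]≡[1+k+k]Ck k) ⟨
    suc (suc (k + k)) * (suc (k + k) C suc k)
      ≡⟨ [k+1]*[n+1]C[k+1]≡[n+1]*nCk (suc (k + k)) (suc k) ⟨
    suc (suc k) * (suc (suc (k + k)) C suc (suc k))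
      ≡⟨ cong (λ n → suc (suc k) * (n C suc (suc k))) (2*[1+k]≡2+[k+k] k) ⟨
    suc (suc k) * (2 * suc k C suc (suc k)) ∎

  -- catalan k = (2k C k) ∸ (2k C (k+1)), so the division defining it is exact.
  [k+1]*catalan[k]≡[2k]Ck : ∀ k → suc k * catalan k ≡ (2 * k) C k
  [k+1]*catalan[k]≡[2k]Ck k = trans (cong (suc k *_) catalan≡difference) [k+1]*difference≡B
    where
    B = (2 * k) C k
    difference = B ∸ (2 * k) C suc k
    [k+1]*difference≡B : suc k * difference ≡ B
    [k+1]*difference≡B = begin
      suc k * (B ∸ (2 * k) C suc k)          ≡⟨ *-distribˡ-∸ (suc k) B ((2 * k) C suc k) ⟩
      suc k * B ∸ suc k * ((2 * k) C suc k)  ≡⟨ cong (suc k * B ∸_) (k*[2k]Ck≡[k+1]*[2k]C[k+1] k) ⟨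
      (B + k * B) ∸ k * B                    ≡⟨ m+n∸n≡m B (k * B) ⟩
      B                                      ∎
    catalan≡difference : catalan k ≡ difference
    catalan≡difference = begin
      B / suc k                     ≡⟨ cong (_/ suc k) [k+1]*difference≡B ⟨
      (suc k * difference) / suc k  ≡⟨ cong (_/ suc k) (*-comm (suc k) difference) ⟩
      (difference * suc k) / suc k  ≡⟨ m*n/n≡m difference (suc k) ⟩
      difference                    ∎

  [k+1]*[2k+2]C[k+1]≡2[2k+1]*[2k]Ck :
    ∀ k → suc k * ((2 * suc k) C suc k) ≡ 2 * suc (2 * k) * ((2 * k) C k)
  [k+1]*[2k+2]C[k+1]≡2[2k+1]*[2k]Ck k = *-cancelˡ-≡ _ _ (suc k) (begin
    suc k * (suc k * (2 * suc k C suc k))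
      ≡⟨ cong (λ n → suc k * (suc k * (n C suc k))) (2*[1+k]≡2+[k+k] k) ⟩
    suc k * (suc k * (suc (suc (k + k)) C suc k))
      ≡⟨ cong (suc k *_) ([k+1]*[n+1]C[k+1]≡[n+1]*nCk (suc (k + k)) k) ⟩
    suc k * (suc (suc (k + k)) * (suc (k + k) C k))
      ≡⟨ x∙yz≈y∙xz (suc k) (suc (suc (k + k))) (suc (k + k) C k) ⟩
    suc (suc (k + k)) * (suc k * (suc (k + k) C k))
      ≡⟨ cong (λ c → suc (suc (k + k)) * (suc k * c)) ([1+k+k]C[1+k]≡[1+k+k]Ck k) ⟨
    suc (suc (k + k)) * (suc k * (suc (k + k) C suc k))
      ≡⟨ cong (suc (suc (k + k)) *_) ([k+1]*[n+1]C[k+1]≡[n+1]*nCk (k + k) k) ⟩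
    suc (suc (k + k)) * (suc (k + k) * ((k + k) C k))
      ≡⟨ solve₁ k ((k + k) C k) ⟩
    suc k * (2 * suc (2 * k) * ((k + k) C k))
      ≡⟨ cong (λ n → suc k * (2 * suc (2 * k) * (n C k))) (cong (_+_ k) (+-identityʳ k)) ⟨
    suc k * (2 * suc (2 * k) * ((2 * k) C k)) ∎)
    where
    solve₁ : ∀ k b → suc (suc (k + k)) * (suc (k + k) * b) ≡ suc k * (2 * suc (2 * k) * b)
    solve₁ = solve-∀

  catalan-recurrence : ∀ k → suc (suc k) * catalan (suc k) ≡ 2 * suc (2 * k) * catalan k
  catalan-recurrence k = *-cancelˡ-≡ _ _ (suc k) (begin
    suc k * (suc (suc k) * catalan (suc k))  ≡⟨ cong (suc k *_) ([k+1]*catalan[k]≡[2k]Ck (suc k)) ⟩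
    suc k * ((2 * suc k) C suc k)             ≡⟨ [k+1]*[2k+2]C[k+1]≡2[2k+1]*[2k]Ck k ⟩
    2 * suc (2 * k) * ((2 * k) C k)           ≡⟨ cong (2 * suc (2 * k) *_) ([k+1]*catalan[k]≡[2k]Ck k) ⟨
    2 * suc (2 * k) * (suc k * catalan k)     ≡⟨ x∙yz≈y∙xz (2 * suc (2 * k)) (suc k) (catalan k) ⟩
    suc k * (2 * suc (2 * k) * catalan k)     ∎)

module PowerSeries where
  open import Data.Nat using (zero; suc; z≤n; s≤s)
  import Data.Nat.Properties as ℕₚ
  open import Data.Integer using (_+_; _*_; -_; 0ℤ; 1ℤ; _^_; _≟_; +-*-rawRing)
  open import Data.Integer.Properties
  open import Data.Integer.Tactic.RingSolver using (solve-∀)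
  open import Data.Maybe using (Maybe; just; nothing)
  open import Data.Product using (_,_)
  open import Level using (0ℓ)
  open import Relation.Binary.Structures using (IsEquivalence)
  open import Algebra.Bundles using (CommutativeRing)
  import Algebra.Solver.Ring.AlmostCommutativeRing as ACR
  open import Relation.Nullary using (yes; no)
  import Relation.Binary.Reasoning.Setoid
  open import Relation.Binary.PropositionalEquality using (refl; sym; trans; cong; cong₂; module ≡-Reasoning)
  open ≡-Reasoning

  Series : Set
  Series = ℕ → ℤ

  infix 4 _≋_ _≡[≤_]_
  infixl 6 _⊕_ _⊝_
  infixl 7 _⊛_ _·_
  infix 8 ⊖_

  _≋_ : Series → Series → Set
  f ≋ g = ∀ i → f i ≡ g i

  _≡[≤_]_ : Series → ℕ → Series → Set
  f ≡[≤ m ] g = ∀ i → i ≤ m → f i ≡ g i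

  tail : Series → Series
  tail f i = f (suc i)

  _⊛_ : Series → Series → Series
  (f ⊛ g) zero    = f 0 * g 0
  (f ⊛ g) (suc m) = f 0 * g (suc m) + (tail f ⊛ g) m

  _⊕_ : Series → Series → Series
  (f ⊕ g) i = f i + g i

  ⊖_ : Series → Series
  (⊖ f) i = - f i

  _⊝_ : Series → Series → Series
  f ⊝ g = f ⊕ ⊖ g

  _·_ : ℤ → Series → Series
  (a · f) i = a * f i

  const : ℤ → Series
  const a zero    = a
  const a (suc _) = 0ℤ

  𝟘 𝟙 : Series
  𝟘 _ = 0ℤ
  𝟙 = const 1ℤ

  shift : Series → Series
  shift f zero    = 0ℤ
  shift f (suc i) = f i

  X : Series
  X = shift 𝟙

  θ : Series → Series
  θ f i = + i * f i

  alternate : Series → Series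
  alternate f i = -1ℤ ^ i * f i

  ⊛-cong-≤ : ∀ m {f f′ g g′} → f ≡[≤ m ] f′ → g ≡[≤ m ] g′ → (f ⊛ g) m ≡ (f′ ⊛ g′) m
  ⊛-cong-≤ zero    f≡f′ g≡g′ = cong₂ _*_ (f≡f′ 0 z≤n) (g≡g′ 0 z≤n)
  ⊛-cong-≤ (suc m) f≡f′ g≡g′ =
    cong₂ _+_ (cong₂ _*_ (f≡f′ 0 z≤n) (g≡g′ (suc m) ℕₚ.≤-refl))
              (⊛-cong-≤ m (λ i i≤m → f≡f′ (suc i) (s≤s i≤m)) (λ i i≤m → g≡g′ i (ℕₚ.m≤n⇒m≤1+n i≤m)))

  ⊛-cong : ∀ {f f′ g g′} → f ≋ f′ → g ≋ g′ → f ⊛ g ≋ f′ ⊛ g′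
  ⊛-cong f≋f′ g≋g′ m = ⊛-cong-≤ m (λ i _ → f≋f′ i) (λ i _ → g≋g′ i)

  ⊕-cong : ∀ {f f′ g g′} → f ≋ f′ → g ≋ g′ → f ⊕ g ≋ f′ ⊕ g′
  ⊕-cong f≋f′ g≋g′ i = cong₂ _+_ (f≋f′ i) (g≋g′ i)

  ⊛-sucʳ : ∀ f g m → (f ⊛ g) (suc m) ≡ (f ⊛ tail g) m + f (suc m) * g 0
  ⊛-sucʳ f g zero    = refl
  ⊛-sucʳ f g (suc m) =
    trans (cong (_+_ (f 0 * g (suc (suc m)))) (⊛-sucʳ (tail f) g m))
          (sym (+-assoc (f 0 * g (suc (suc m))) _ _))

  ⊛-comm : ∀ f g → f ⊛ g ≋ g ⊛ f
  ⊛-comm f g zero    = *-comm (f 0) (g 0)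
  ⊛-comm f g (suc m) = begin
    f 0 * g (suc m) + (tail f ⊛ g) m  ≡⟨ cong₂ _+_ (*-comm (f 0) (g (suc m))) (⊛-comm (tail f) g m) ⟩
    g (suc m) * f 0 + (g ⊛ tail f) m  ≡⟨ +-comm (g (suc m) * f 0) _ ⟩
    (g ⊛ tail f) m + g (suc m) * f 0  ≡⟨ ⊛-sucʳ g f m ⟨
    (g ⊛ f) (suc m)                   ∎

  ⊛-distribʳ-⊕ : ∀ f f′ g → (f ⊕ f′) ⊛ g ≋ f ⊛ g ⊕ f′ ⊛ g
  ⊛-distribʳ-⊕ f f′ g zero    = *-distribʳ-+ (g 0) (f 0) (f′ 0)
  ⊛-distribʳ-⊕ f f′ g (suc m) =
    trans (cong₂ _+_ (*-distribʳ-+ (g (suc m)) (f 0) (f′ 0)) (⊛-distribʳ-⊕ (tail f) (tail f′) g m))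
          (+-interchange (f 0 * g (suc m)) (f′ 0 * g (suc m)) _ _)
    where
    +-interchange : ∀ a b c d → (a + b) + (c + d) ≡ (a + c) + (b + d)
    +-interchange = solve-∀

  ·-⊛ : ∀ a f g → a · f ⊛ g ≋ a · (f ⊛ g)
  ·-⊛ a f g zero    = *-assoc a (f 0) (g 0)
  ·-⊛ a f g (suc m) =
    trans (cong₂ _+_ (*-assoc a (f 0) (g (suc m))) (·-⊛ a (tail f) g m))
          (sym (*-distribˡ-+ a _ _))

  ⊖-⊛ : ∀ f g → ⊖ f ⊛ g ≋ ⊖ (f ⊛ g)
  ⊖-⊛ f g i = begin
    (⊖ f ⊛ g) i         ≡⟨ ⊛-cong {g = g} (λ j → sym (-1*i≡-i (f j))) (λ _ → refl) i ⟩
    (-1ℤ · f ⊛ g) i     ≡⟨ ·-⊛ -1ℤ f g i ⟩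
    -1ℤ * (f ⊛ g) i     ≡⟨ -1*i≡-i _ ⟩
    - (f ⊛ g) i         ∎

  ⊛-assoc : ∀ f g h → (f ⊛ g) ⊛ h ≋ f ⊛ (g ⊛ h)
  ⊛-assoc f g h zero    = *-assoc (f 0) (g 0) (h 0)
  ⊛-assoc f g h (suc m) = begin
    f 0 * g 0 * h (suc m) + ((f 0 · tail g ⊕ tail f ⊛ g) ⊛ h) m
      ≡⟨ cong (_+_ (f 0 * g 0 * h (suc m))) (⊛-distribʳ-⊕ (f 0 · tail g) (tail f ⊛ g) h m) ⟩
    f 0 * g 0 * h (suc m) + ((f 0 · tail g ⊛ h) m + ((tail f ⊛ g) ⊛ h) m)
      ≡⟨ cong₂ (λ u v → f 0 * g 0 * h (suc m) + (u + v)) (·-⊛ (f 0) (tail g) h m) (⊛-assoc (tail f) g h m) ⟩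
    f 0 * g 0 * h (suc m) + (f 0 * (tail g ⊛ h) m + (tail f ⊛ (g ⊛ h)) m)
      ≡⟨ regroup (f 0) (g 0) (h (suc m)) _ _ ⟩
    f 0 * (g 0 * h (suc m) + (tail g ⊛ h) m) + (tail f ⊛ (g ⊛ h)) m ∎
    where
    regroup : ∀ a b c d e → a * b * c + (a * d + e) ≡ a * (b * c + d) + e
    regroup = solve-∀

  𝟘-⊛ : ∀ g → 𝟘 ⊛ g ≋ 𝟘
  𝟘-⊛ g zero    = *-zeroˡ (g 0)
  𝟘-⊛ g (suc m) = trans (+-identityˡ _) (𝟘-⊛ g m)

  const-⊛ : ∀ a g → const a ⊛ g ≋ a · g
  const-⊛ a g zero    = refl
  const-⊛ a g (suc m) =
    trans (cong (_+_ (a * g (suc m))) (trans (⊛-cong {f′ = 𝟘} {g = g} (λ _ → refl) (λ _ → refl) m) (𝟘-⊛ g m)))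
          (+-identityʳ _)

  𝟙-⊛ : ∀ g → 𝟙 ⊛ g ≋ g
  𝟙-⊛ g i = trans (const-⊛ 1ℤ g i) (*-identityˡ (g i))

  ≋-isEquivalence : IsEquivalence _≋_
  ≋-isEquivalence = record
    { refl = λ _ → refl ; sym = λ p i → sym (p i) ; trans = λ p q i → trans (p i) (q i) }

  ring : CommutativeRing 0ℓ 0ℓ
  ring = record
    { Carrier = Series ; _≈_ = _≋_ ; _+_ = _⊕_ ; _*_ = _⊛_ ; -_ = ⊖_ ; 0# = 𝟘 ; 1# = 𝟙
    ; isCommutativeRing = record
      { isRing = record
        { +-isAbelianGroup = record
          { isGroup = record
            { isMonoid = record
              { isSemigroup = record
                { isMagma = record
                  { isEquivalence = ≋-isEquivalence ; ∙-cong = λ p q i → cong₂ _+_ (p i) (q i) }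
                ; assoc = λ f g h i → +-assoc (f i) (g i) (h i) }
              ; identity = (λ f i → +-identityˡ (f i)) , (λ f i → +-identityʳ (f i)) }
            ; inverse = (λ f i → +-inverseˡ (f i)) , (λ f i → +-inverseʳ (f i))
            ; ⁻¹-cong = λ p i → cong -_ (p i) }
          ; comm = λ f g i → +-comm (f i) (g i) }
        ; *-cong = ⊛-cong
        ; *-assoc = ⊛-assoc
        ; *-identity = 𝟙-⊛ , (λ f i → trans (⊛-comm f 𝟙 i) (𝟙-⊛ f i))
        ; distrib = (λ f g h i → trans (⊛-comm f (g ⊕ h) i)
                                   (trans (⊛-distribʳ-⊕ g h f i) (cong₂ _+_ (⊛-comm g f i) (⊛-comm h f i))))
                  , (λ f g h → ⊛-distribʳ-⊕ g h f) }
      ; *-comm = ⊛-comm } }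

  const-homomorphism : ACR._-Raw-AlmostCommutative⟶_ +-*-rawRing (ACR.fromCommutativeRing ring)
  const-homomorphism = record
    { ⟦_⟧    = const
    ; +-homo = λ a b → λ { zero → refl ; (suc i) → refl }
    ; *-homo = λ a b i → sym (trans (const-⊛ a (const b) i) (·-const a b i))
    ; -‿homo = λ a → λ { zero → refl ; (suc i) → refl }
    ; 0-homo = λ { zero → refl ; (suc i) → refl }
    ; 1-homo = λ { zero → refl ; (suc i) → refl } }
    where
    ·-const : ∀ a b → a · const b ≋ const (a * b)
    ·-const a b zero    = refl
    ·-const a b (suc i) = *-zeroʳ a

  const-≟ : ∀ a b → Maybe (const a ≋ const b)
  const-≟ a b with a ≟ b
  ... | yes refl = just (λ _ → refl)
  ... | no _     = nothing

  module ≋-Reasoning = Relation.Binary.Reasoning.Setoid (CommutativeRing.setoid ring)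

  open import Algebra.Solver.Ring +-*-rawRing (ACR.fromCommutativeRing ring) const-homomorphism const-≟
    public using (solve; _:=_; con; _:+_; _:*_; :-_; _:-_)

  shift-⊛ : ∀ f g → shift f ⊛ g ≋ shift (f ⊛ g)
  shift-⊛ f g zero    = *-zeroˡ (g 0)
  shift-⊛ f g (suc m) = +-identityˡ _

  X-⊛ : ∀ f → X ⊛ f ≋ shift f
  X-⊛ f zero    = shift-⊛ 𝟙 f zero
  X-⊛ f (suc m) = trans (shift-⊛ 𝟙 f (suc m)) (𝟙-⊛ f m)

  θ-⊛ : ∀ f g → θ (f ⊛ g) ≋ θ f ⊛ g ⊕ f ⊛ θ g
  θ-⊛ f g zero    = θ-at-0 (f 0) (g 0)
    where
    θ-at-0 : ∀ a b → + 0 * (a * b) ≡ + 0 * a * b + a * (+ 0 * b)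
    θ-at-0 = solve-∀
  θ-⊛ f g (suc m) = begin
    + suc m * (f 0 * g (suc m) + c)
      ≡⟨ expand (+ m) (f 0) (g (suc m)) c ⟩
    f 0 * (+ suc m * g (suc m)) + (c + + m * c)
      ≡⟨ cong (λ u → f 0 * (+ suc m * g (suc m)) + (c + u)) (θ-⊛ (tail f) g m) ⟩
    f 0 * (+ suc m * g (suc m)) + (c + ((θ (tail f) ⊛ g) m + (tail f ⊛ θ g) m))
      ≡⟨ regroup (f 0 * (+ suc m * g (suc m))) c _ _ ⟩
    (c + (θ (tail f) ⊛ g) m) + (f 0 * (+ suc m * g (suc m)) + (tail f ⊛ θ g) m)
      ≡⟨ cong (_+ (f ⊛ θ g) (suc m)) (⊛-distribʳ-⊕ (tail f) (θ (tail f)) g m) ⟨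
    ((tail f ⊕ θ (tail f)) ⊛ g) m + (f ⊛ θ g) (suc m)
      ≡⟨ cong (_+ (f ⊛ θ g) (suc m)) (⊛-cong {g = g} tail-θ (λ _ → refl) m) ⟩
    (tail (θ f) ⊛ g) m + (f ⊛ θ g) (suc m)
      ≡⟨ cong (_+ (f ⊛ θ g) (suc m)) (+-identityˡ ((tail (θ f) ⊛ g) m)) ⟨
    (θ f ⊛ g) (suc m) + (f ⊛ θ g) (suc m) ∎
    where
    c = (tail f ⊛ g) m
    expand : ∀ m a b c → (+ 1 + m) * (a * b + c) ≡ a * ((+ 1 + m) * b) + (c + m * c)
    expand = solve-∀
    regroup : ∀ a c d e → a + (c + (d + e)) ≡ (c + d) + (a + e)
    regroup = solve-∀
    tail-θ : tail f ⊕ θ (tail f) ≋ tail (θ f)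
    tail-θ i = sym (suc-* (+ i) (f (suc i)))

  alternate-⊛ : ∀ f g → alternate (f ⊛ g) ≋ alternate f ⊛ alternate g
  alternate-⊛ f g zero    = unfold (f 0) (g 0)
    where
    unfold : ∀ a b → 1ℤ * (a * b) ≡ 1ℤ * a * (1ℤ * b)
    unfold = solve-∀
  alternate-⊛ f g (suc m) = sym (begin
    alternate f 0 * alternate g (suc m) + (tail (alternate f) ⊛ alternate g) m
      ≡⟨ cong (_+_ (alternate f 0 * alternate g (suc m)))
              (⊛-cong {g = alternate g} (λ i → *-assoc -1ℤ (-1ℤ ^ i) (f (suc i))) (λ _ → refl) m) ⟩
    alternate f 0 * alternate g (suc m) + (-1ℤ · alternate (tail f) ⊛ alternate g) m
      ≡⟨ cong (_+_ (alternate f 0 * alternate g (suc m))) (·-⊛ -1ℤ (alternate (tail f)) (alternate g) m) ⟩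
    alternate f 0 * alternate g (suc m) + -1ℤ * (alternate (tail f) ⊛ alternate g) m
      ≡⟨ cong (λ u → alternate f 0 * alternate g (suc m) + -1ℤ * u) (alternate-⊛ (tail f) g m) ⟨
    (1ℤ * f 0) * ((-1ℤ * s) * g (suc m)) + -1ℤ * (s * (tail f ⊛ g) m)
      ≡⟨ regroup (f 0) s (g (suc m)) ((tail f ⊛ g) m) ⟩
    (-1ℤ * s) * (f 0 * g (suc m) + (tail f ⊛ g) m) ∎)
    where
    s = -1ℤ ^ m
    regroup : ∀ a s b c → (1ℤ * a) * ((-1ℤ * s) * b) + -1ℤ * (s * c) ≡ (-1ℤ * s) * (a * b + c)
    regroup = solve-∀


  ⊛-≡[≤]𝟘 : ∀ {f e} n → f 0 ≡ 0ℤ → e ≡[≤ n ] 𝟘 → f ⊛ e ≡[≤ suc n ] 𝟘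
  ⊛-≡[≤]𝟘 {f} {e} n f₀≡0 e≡𝟘 zero    _ = trans (cong (_* e 0) f₀≡0) (*-zeroˡ (e 0))
  ⊛-≡[≤]𝟘 {f} {e} n f₀≡0 e≡𝟘 (suc m) (s≤s m≤n) = begin
    f 0 * e (suc m) + (tail f ⊛ e) m  ≡⟨ cong (λ a → a * e (suc m) + (tail f ⊛ e) m) f₀≡0 ⟩
    0ℤ * e (suc m) + (tail f ⊛ e) m   ≡⟨ +-identityˡ _ ⟩
    (tail f ⊛ e) m                    ≡⟨ ⊛-cong-≤ m (λ _ _ → refl) (λ i i≤m → e≡𝟘 i (ℕₚ.≤-trans i≤m m≤n)) ⟩
    (tail f ⊛ 𝟘) m                    ≡⟨ ⊛-comm (tail f) 𝟘 m ⟩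
    (𝟘 ⊛ tail f) m                    ≡⟨ 𝟘-⊛ (tail f) m ⟩
    0ℤ                                ∎

module CatalanSeries where
  open CatalanNumbers using (catalan-recurrence)
  open PowerSeries
  open import Data.Nat using (zero; suc)
  open import Data.Integer using (_+_; _*_; -_; 0ℤ; _^_)
  open import Data.Integer.Properties
  open import Data.Integer.Tactic.RingSolver using (solve-∀)
  open import Relation.Binary.PropositionalEquality using (refl; sym; trans; cong; cong₂; subst; module ≡-Reasoning)

  catalanSeries : Series
  catalanSeries zero    = 0ℤ
  catalanSeries (suc k) = + catalan k

  [1-4X]⊛ : ∀ h → (𝟙 ⊝ const (+ 4) ⊛ X) ⊛ h ≋ h ⊝ + 4 · shift h
  [1-4X]⊛ h i = begin
    ((𝟙 ⊝ const (+ 4) ⊛ X) ⊛ h) i  ≡⟨ expand h X i ⟩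
    (h ⊝ const (+ 4) ⊛ (X ⊛ h)) i  ≡⟨ cong (λ u → h i + - u) (const-⊛ (+ 4) (X ⊛ h) i) ⟩
    (h ⊝ + 4 · (X ⊛ h)) i          ≡⟨ cong (λ u → h i + - (+ 4 * u)) (X-⊛ h i) ⟩
    (h ⊝ + 4 · shift h) i          ∎
    where
    open ≡-Reasoning
    expand : ∀ h x → (𝟙 ⊝ const (+ 4) ⊛ x) ⊛ h ≋ h ⊝ const (+ 4) ⊛ (x ⊛ h)
    expand = solve 2 (λ h x → (con (+ 1) :- con (+ 4) :* x) :* h := h :- con (+ 4) :* (x :* h)) (λ _ → refl)

  -- The coefficientwise form of the recurrence (k + 2) C_(k+1) = 2 (2k + 1) C_k.
  θcatalanSeries : (𝟙 ⊝ const (+ 4) ⊛ X) ⊛ θ catalanSeries ≋ X ⊛ (𝟙 ⊝ const (+ 2) ⊛ catalanSeries)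
  θcatalanSeries i = trans ([1-4X]⊛ (θ catalanSeries) i) (trans (coefficient i) (sym (X-⊛ _ i)))
    where
    coefficient : ∀ i → (θ catalanSeries ⊝ + 4 · shift (θ catalanSeries)) i
                      ≡ shift (𝟙 ⊝ const (+ 2) ⊛ catalanSeries) i
    coefficient zero          = refl
    coefficient (suc zero)    = refl
    coefficient (suc (suc k)) = begin
      (+ 1 + (+ 1 + + k)) * + catalan (suc k) + - (+ 4 * ((+ 1 + + k) * + catalan k))
        ≡⟨ cong (_+ - (+ 4 * ((+ 1 + + k) * + catalan k))) recurrence ⟩
      + 2 * (+ 1 + + 2 * + k) * + catalan k + - (+ 4 * ((+ 1 + + k) * + catalan k))
        ≡⟨ simplify (+ k) (+ catalan k) ⟩
      0ℤ + - (+ 2 * + catalan k)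
        ≡⟨ cong (λ u → 0ℤ + - u) (const-⊛ (+ 2) catalanSeries (suc k)) ⟨
      0ℤ + - (const (+ 2) ⊛ catalanSeries) (suc k) ∎
      where
      open ≡-Reasoning
      recurrence : + suc (suc k) * + catalan (suc k) ≡ + 2 * (+ 1 + + 2 * + k) * + catalan k
      recurrence = begin
        + suc (suc k) * + catalan (suc k)     ≡⟨ pos-* (suc (suc k)) (catalan (suc k)) ⟨
        + (suc (suc k) ℕ.* catalan (suc k))   ≡⟨ cong +_ (catalan-recurrence k) ⟩
        + (2 ℕ.* suc (2 ℕ.* k) ℕ.* catalan k) ≡⟨ pos-* (2 ℕ.* suc (2 ℕ.* k)) (catalan k) ⟩
        + (2 ℕ.* suc (2 ℕ.* k)) * + catalan k ≡⟨ cong (_* + catalan k) (pos-* 2 (suc (2 ℕ.* k))) ⟩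
        + 2 * + suc (2 ℕ.* k) * + catalan k   ≡⟨ cong (λ u → + 2 * (+ 1 + u) * + catalan k) (pos-* 2 k) ⟩
        + 2 * (+ 1 + + 2 * + k) * + catalan k ∎
      simplify : ∀ k c → + 2 * (+ 1 + + 2 * k) * c + - (+ 4 * ((+ 1 + k) * c)) ≡ 0ℤ + - (+ 2 * c)
      simplify = solve-∀

  quadraticDefect : Series
  quadraticDefect = catalanSeries ⊝ X ⊝ catalanSeries ⊛ catalanSeries

  θquadraticDefect : (𝟙 ⊝ const (+ 4) ⊛ X) ⊛ θ quadraticDefect ≋ ⊖ (const (+ 4) ⊛ (X ⊛ quadraticDefect))
  θquadraticDefect = begin
    (𝟙 ⊝ const (+ 4) ⊛ X) ⊛ θ quadraticDefect
      ≈⟨ ⊛-cong {𝟙 ⊝ const (+ 4) ⊛ X} (λ _ → refl) θ-expand ⟩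
    (𝟙 ⊝ const (+ 4) ⊛ X) ⊛ (p ⊝ X ⊝ (p ⊛ z ⊕ z ⊛ p))
      ≈⟨ regroup p X z ⟩
    ((𝟙 ⊝ const (+ 4) ⊛ X) ⊛ p) ⊛ (𝟙 ⊝ const (+ 2) ⊛ z) ⊝ (𝟙 ⊝ const (+ 4) ⊛ X) ⊛ X
      ≈⟨ ⊕-cong {g = ⊖ ((𝟙 ⊝ const (+ 4) ⊛ X) ⊛ X)}
           (⊛-cong {g = 𝟙 ⊝ const (+ 2) ⊛ z} θcatalanSeries (λ _ → refl)) (λ _ → refl) ⟩
    (X ⊛ (𝟙 ⊝ const (+ 2) ⊛ z)) ⊛ (𝟙 ⊝ const (+ 2) ⊛ z) ⊝ (𝟙 ⊝ const (+ 4) ⊛ X) ⊛ X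
      ≈⟨ simplify X z ⟩
    ⊖ (const (+ 4) ⊛ (X ⊛ quadraticDefect)) ∎
    where
    open ≋-Reasoning
    z = catalanSeries
    p = θ catalanSeries
    θX≋X : θ X ≋ X
    θX≋X zero          = refl
    θX≋X (suc zero)    = refl
    θX≋X (suc (suc i)) = *-zeroʳ (+ suc (suc i))
    θ-expand : θ quadraticDefect ≋ p ⊝ X ⊝ (p ⊛ z ⊕ z ⊛ p)
    θ-expand i = trans (distribute (+ i) (z i) (X i) ((z ⊛ z) i))
                       (cong₂ (λ u v → + i * z i + - u + - v) (θX≋X i) (θ-⊛ z z i))
      where
      distribute : ∀ i a b c → i * (a + - b + - c) ≡ i * a + - (i * b) + - (i * c)
      distribute = solve-∀
    regroup : ∀ p x z → (𝟙 ⊝ const (+ 4) ⊛ x) ⊛ (p ⊝ x ⊝ (p ⊛ z ⊕ z ⊛ p))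
                      ≋ ((𝟙 ⊝ const (+ 4) ⊛ x) ⊛ p) ⊛ (𝟙 ⊝ const (+ 2) ⊛ z) ⊝ (𝟙 ⊝ const (+ 4) ⊛ x) ⊛ x
    regroup = solve 3 (λ p x z →
      (con (+ 1) :- con (+ 4) :* x) :* (p :- x :- (p :* z :+ z :* p))
        := ((con (+ 1) :- con (+ 4) :* x) :* p) :* (con (+ 1) :- con (+ 2) :* z)
           :- (con (+ 1) :- con (+ 4) :* x) :* x) (λ _ → refl)
    simplify : ∀ x z → (x ⊛ (𝟙 ⊝ const (+ 2) ⊛ z)) ⊛ (𝟙 ⊝ const (+ 2) ⊛ z) ⊝ (𝟙 ⊝ const (+ 4) ⊛ x) ⊛ x
                     ≋ ⊖ (const (+ 4) ⊛ (x ⊛ (z ⊝ x ⊝ z ⊛ z)))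
    simplify = solve 2 (λ x z →
      (x :* (con (+ 1) :- con (+ 2) :* z)) :* (con (+ 1) :- con (+ 2) :* z) :- (con (+ 1) :- con (+ 4) :* x) :* x
        := :- (con (+ 4) :* (x :* (z :- x :- z :* z)))) (λ _ → refl)

  -- Coefficient k + 1 of θquadraticDefect reads (k + 1) Q_(k+1) = 4 (k - 1) Q_k.
  quadraticDefect≋𝟘 : quadraticDefect ≋ 𝟘
  quadraticDefect≋𝟘 zero    = refl
  quadraticDefect≋𝟘 (suc k) = *-cancelˡ-≡ (+ suc k) (Q (suc k)) 0ℤ (begin
    + suc k * Q (suc k)                         ≡⟨ +-identityʳ _ ⟨
    + suc k * Q (suc k) + - (+ 4 * 0ℤ)          ≡⟨ cong (λ u → + suc k * Q (suc k) + - (+ 4 * u)) (*-zeroʳ (+ k)) ⟨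
    + suc k * Q (suc k) + - (+ 4 * (+ k * 0ℤ))  ≡⟨ subst (λ q → + suc k * Q (suc k) + - (+ 4 * (+ k * q)) ≡ - (+ 4 * q))
                                                      (quadraticDefect≋𝟘 k) coefficient ⟩
    0ℤ                                          ≡⟨ *-zeroʳ (+ suc k) ⟨
    + suc k * 0ℤ                                ∎)
    where
    open ≡-Reasoning
    Q = quadraticDefect
    coefficient : + suc k * Q (suc k) + - (+ 4 * (+ k * Q k)) ≡ - (+ 4 * Q k)
    coefficient = begin
      + suc k * Q (suc k) + - (+ 4 * (+ k * Q k)) ≡⟨ [1-4X]⊛ (θ Q) (suc k) ⟨
      ((𝟙 ⊝ const (+ 4) ⊛ X) ⊛ θ Q) (suc k)     ≡⟨ θquadraticDefect (suc k) ⟩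
      - (const (+ 4) ⊛ (X ⊛ Q)) (suc k)         ≡⟨ cong -_ (const-⊛ (+ 4) (X ⊛ Q) (suc k)) ⟩
      - (+ 4 * (X ⊛ Q) (suc k))                 ≡⟨ cong (λ u → - (+ 4 * u)) (X-⊛ Q (suc k)) ⟩
      - (+ 4 * Q k)                             ∎

  catalanSeries-square : catalanSeries ⊛ catalanSeries ≋ catalanSeries ⊝ X
  catalanSeries-square i = sym (i-j≡0⇒i≡j _ _ (quadraticDefect≋𝟘 i))

  alternatingCatalanSeries : Series
  alternatingCatalanSeries = alternate catalanSeries

  alternatingCatalanSeries-square :
    alternatingCatalanSeries ⊛ alternatingCatalanSeries ≋ alternatingCatalanSeries ⊕ X
  alternatingCatalanSeries-square i = begin
    (alternate catalanSeries ⊛ alternate catalanSeries) i  ≡⟨ alternate-⊛ catalanSeries catalanSeries i ⟨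
    -1ℤ ^ i * (catalanSeries ⊛ catalanSeries) i           ≡⟨ cong (-1ℤ ^ i *_) (catalanSeries-square i) ⟩
    -1ℤ ^ i * (catalanSeries i + - X i)                   ≡⟨ *-distribˡ-+ (-1ℤ ^ i) (catalanSeries i) (- X i) ⟩
    alternatingCatalanSeries i + -1ℤ ^ i * - X i          ≡⟨ cong (_+_ (alternatingCatalanSeries i)) (alternate-⊖X i) ⟩
    alternatingCatalanSeries i + X i                      ∎
    where
    open ≡-Reasoning
    alternate-⊖X : ∀ i → -1ℤ ^ i * - X i ≡ X i
    alternate-⊖X zero          = refl
    alternate-⊖X (suc zero)    = refl
    alternate-⊖X (suc (suc i)) = *-zeroʳ (-1ℤ ^ suc (suc i))

module FibonacciSeries where
  open PowerSeries
  open CatalanSeries using (alternatingCatalanSeries; alternatingCatalanSeries-square)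
  open import Data.Nat using (zero; suc; _<_; s≤s)
  open import Data.Nat.Properties using (_≤?_; ≰⇒>; <⇒≤; m≤n⇒m∸n≡0; +-∸-assoc; +-comm)
  open import Data.Nat.Combinatorics using (_C_; nCk+nC[k+1]≡[n+1]C[k+1])
  open import Data.Integer.Properties using (pos-+)
  open import Relation.Nullary using (yes; no)
  open import Data.Integer using (_+_)
  open import Relation.Binary.PropositionalEquality using (refl; sym; trans; cong; module ≡-Reasoning)

  fibonacciSeries : ℕ → Series
  fibonacciSeries n k = + ((n ∸ k) C k)

  [1+n∸k]C[1+k]≡[n∸k]C[1+k]+[n∸k]Ck : ∀ n k → (suc n ∸ k) C suc k ≡ (n ∸ k) C suc k ℕ.+ (n ∸ k) C k
  [1+n∸k]C[1+k]≡[n∸k]C[1+k]+[n∸k]Ck n k with k ≤? n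
  ... | yes k≤n = begin
    (suc n ∸ k) C suc k                  ≡⟨ cong (_C suc k) (+-∸-assoc 1 k≤n) ⟩
    suc (n ∸ k) C suc k                  ≡⟨ nCk+nC[k+1]≡[n+1]C[k+1] (n ∸ k) k ⟨
    (n ∸ k) C k ℕ.+ (n ∸ k) C suc k      ≡⟨ +-comm ((n ∸ k) C k) _ ⟩
    (n ∸ k) C suc k ℕ.+ (n ∸ k) C k      ∎
    where open ≡-Reasoning
  ... | no k≰n = bothVanish (≰⇒> k≰n)
    where
    bothVanish : n < k → (suc n ∸ k) C suc k ≡ (n ∸ k) C suc k ℕ.+ (n ∸ k) C k
    bothVanish n<k@(s≤s _) rewrite m≤n⇒m∸n≡0 n<k | m≤n⇒m∸n≡0 (<⇒≤ n<k) = refl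

  fibonacciSeries-pascal : ∀ n → fibonacciSeries (suc (suc n)) ≋ fibonacciSeries (suc n) ⊕ shift (fibonacciSeries n)
  fibonacciSeries-pascal n zero    = refl
  fibonacciSeries-pascal n (suc k) =
    trans (cong +_ ([1+n∸k]C[1+k]≡[n∸k]C[1+k]+[n∸k]Ck n k)) (pos-+ ((n ∸ k) C suc k) ((n ∸ k) C k))

  fibonacciRemainder : ℕ → Series
  fibonacciRemainder n =
    alternatingCatalanSeries ⊛ fibonacciSeries (suc n) ⊕ X ⊛ fibonacciSeries n

  fibonacciRemainder-suc : ∀ n → fibonacciRemainder (suc n) ≋ alternatingCatalanSeries ⊛ fibonacciRemainder n
  fibonacciRemainder-suc n = begin
    g ⊛ F (suc (suc n)) ⊕ X ⊛ F (suc n)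
      ≈⟨ ⊕-cong {g = X ⊛ F (suc n)} (⊛-cong {g} (λ _ → refl) pascal) (λ _ → refl) ⟩
    g ⊛ (F (suc n) ⊕ X ⊛ F n) ⊕ X ⊛ F (suc n)
      ≈⟨ regroup₁ g X (F (suc n)) (F n) ⟩
    (g ⊕ X) ⊛ F (suc n) ⊕ g ⊛ (X ⊛ F n)
      ≈⟨ ⊕-cong {g = g ⊛ (X ⊛ F n)}
           (⊛-cong {g = F (suc n)} (λ i → sym (alternatingCatalanSeries-square i)) (λ _ → refl)) (λ _ → refl) ⟩
    (g ⊛ g) ⊛ F (suc n) ⊕ g ⊛ (X ⊛ F n)
      ≈⟨ regroup₂ g X (F (suc n)) (F n) ⟩
    g ⊛ (g ⊛ F (suc n) ⊕ X ⊛ F n) ∎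
    where
    open ≋-Reasoning
    g = alternatingCatalanSeries
    F = fibonacciSeries
    pascal : F (suc (suc n)) ≋ F (suc n) ⊕ X ⊛ F n
    pascal i = trans (fibonacciSeries-pascal n i) (cong (_+_ (F (suc n) i)) (sym (X-⊛ (F n) i)))
    regroup₁ : ∀ g x a b → g ⊛ (a ⊕ x ⊛ b) ⊕ x ⊛ a ≋ (g ⊕ x) ⊛ a ⊕ g ⊛ (x ⊛ b)
    regroup₁ = solve 4 (λ g x a b → g :* (a :+ x :* b) :+ x :* a := (g :+ x) :* a :+ g :* (x :* b)) (λ _ → refl)
    regroup₂ : ∀ g x a b → (g ⊛ g) ⊛ a ⊕ g ⊛ (x ⊛ b) ≋ g ⊛ (g ⊛ a ⊕ x ⊛ b)
    regroup₂ = solve 4 (λ g x a b → (g :* g) :* a :+ g :* (x :* b) := g :* (g :* a :+ x :* b)) (λ _ → refl)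

  fibonacciRemainder-vanishes : ∀ n → fibonacciRemainder n ≡[≤ suc n ] 𝟘
  fibonacciRemainder-vanishes zero    zero          _                  = refl
  fibonacciRemainder-vanishes zero    (suc zero)    _                  = refl
  fibonacciRemainder-vanishes zero    (suc (suc i)) (s≤s ())
  fibonacciRemainder-vanishes (suc n) i             i≤2+n              =
    trans (fibonacciRemainder-suc n i) (⊛-≡[≤]𝟘 (suc n) refl (fibonacciRemainder-vanishes n) i i≤2+n)

module Compositions where
  open import Data.Nat using (zero; suc; _+_; z≤n; s≤s)
  open import Data.Nat.Properties
  open import Data.Nat.ListAction using (sum)
  open import Data.List using ([]; _∷_; _++_; [_])
  open import Data.List.Properties using (∷-injectiveʳ)
  open import Data.List.Relation.Unary.AllPairs using ([]; _∷_)
  open import Data.List.Relation.Unary.All using (All; []; _∷_)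
  open import Data.List.Relation.Unary.Any using (here)
  open import Data.List.Membership.Propositional.Properties using (∈-map⁺; ∈-map⁻; ∈-++⁺ˡ; ∈-++⁺ʳ; ∈-++⁻)
  import Data.List.Relation.Unary.Unique.Propositional.Properties as Unique
  open import Data.Product using (_,_; ∃₂)
  open import Data.Sum using (inj₁; inj₂)
  open import Relation.Nullary using (¬_)
  open import Function.Bundles using (mk⇔; Equivalence)
  open import Relation.Binary.PropositionalEquality using (refl; sym; trans; cong; cong₂; subst)

  -- Unlike IsComposition, this admits the empty composition of 0.
  IsComposition⁰ : ℕ → List ℕ → Set
  IsComposition⁰ m c = All (λ x → 1 ≤ x) c × sum c ≡ m

  IsComposition⁰⇔IsComposition : ∀ {m} c → 1 ≤ m → IsComposition⁰ m c ⇔ IsComposition m c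
  IsComposition⁰⇔IsComposition []      (s≤s z≤n) = mk⇔ (λ { (_ , ()) }) (λ { (() , _) })
  IsComposition⁰⇔IsComposition (x ∷ c) _         =
    mk⇔ (λ (positive , sum≡) → s≤s z≤n , positive , sum≡) (λ (_ , positive , sum≡) → positive , sum≡)

  -- prependParts G j r lists the h ∷ t with j < h ≤ j + 1 + r and t ∈ G (j + 1 + r ∸ h).
  prependParts : (ℕ → List (List ℕ)) → ℕ → ℕ → List (List ℕ)
  prependParts G j zero    = map (suc j ∷_) (G zero)
  prependParts G j (suc r) = map (suc j ∷_) (G (suc r)) ++ prependParts G (suc j) r

  compositionsWithin : ℕ → ℕ → List (List ℕ)
  compositionsWithin fuel       zero    = [ [] ]
  compositionsWithin zero       (suc m) = []
  compositionsWithin (suc fuel) (suc r) = prependParts (compositionsWithin fuel) 0 r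

  compositions : ℕ → List (List ℕ)
  compositions m = compositionsWithin m m

  prependParts-cong-≤ : ∀ {G G′} j r → (∀ s → s ≤ r → G s ≡ G′ s) → prependParts G j r ≡ prependParts G′ j r
  prependParts-cong-≤ j zero    G≡G′ = cong (map (suc j ∷_)) (G≡G′ 0 z≤n)
  prependParts-cong-≤ j (suc r) G≡G′ =
    cong₂ _++_ (cong (map (suc j ∷_)) (G≡G′ (suc r) ≤-refl))
               (prependParts-cong-≤ (suc j) r (λ s s≤r → G≡G′ s (m≤n⇒m≤1+n s≤r)))

  compositionsWithin-fuel : ∀ f f′ m → m ≤ f → m ≤ f′ → compositionsWithin f m ≡ compositionsWithin f′ m
  compositionsWithin-fuel f        f′        zero    _         _          = refl
  compositionsWithin-fuel (suc f) (suc f′) (suc r) (s≤s r≤f) (s≤s r≤f′) =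
    prependParts-cong-≤ 0 r (λ s s≤r → compositionsWithin-fuel f f′ s (≤-trans s≤r r≤f) (≤-trans s≤r r≤f′))

  prependParts-sound : ∀ G → (∀ s c → c ∈ G s → IsComposition⁰ s c) →
                       ∀ j r c → c ∈ prependParts G j r → IsComposition⁰ (suc j + r) c
  prependParts-sound G G-sound j zero c c∈ with ∈-map⁻ (suc j ∷_) c∈
  ... | t , t∈ , refl with G-sound 0 t t∈
  ...   | positive , sum≡ = s≤s z≤n ∷ positive , cong (_+_ (suc j)) sum≡
  prependParts-sound G G-sound j (suc r) c c∈ with ∈-++⁻ (map (suc j ∷_) (G (suc r))) c∈
  ... | inj₁ c∈head with ∈-map⁻ (suc j ∷_) c∈head
  ...   | t , t∈ , refl with G-sound (suc r) t t∈
  ...     | positive , sum≡ = s≤s z≤n ∷ positive , cong (_+_ (suc j)) sum≡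
  prependParts-sound G G-sound j (suc r) c c∈ | inj₂ c∈rest with prependParts-sound G G-sound (suc j) r c c∈rest
  ... | positive , sum≡ = positive , trans sum≡ (sym (+-suc (suc j) r))

  compositionsWithin-sound : ∀ f m c → c ∈ compositionsWithin f m → IsComposition⁰ m c
  compositionsWithin-sound f       zero    c (here refl) = [] , refl
  compositionsWithin-sound (suc f) (suc r) c c∈          =
    prependParts-sound (compositionsWithin f) (compositionsWithin-sound f) 0 r c c∈

  prependParts-complete : ∀ G j r h t s → t ∈ G s → suc j ≤ h → h + s ≡ suc j + r →
                          (h ∷ t) ∈ prependParts G j r
  prependParts-complete G j zero h t s t∈ j<h h+s≡ =
    subst (λ u → (u ∷ t) ∈ map (suc j ∷_) (G zero)) (sym h≡1+j)
          (∈-map⁺ (suc j ∷_) (subst (λ u → t ∈ G u) s≡0 t∈))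
    where
    s≡0 : s ≡ 0
    s≡0 = n≤0⇒n≡0 (+-cancelˡ-≤ (suc j) s 0 (≤-trans (+-monoˡ-≤ s j<h) (≤-reflexive h+s≡)))
    h≡1+j : h ≡ suc j
    h≡1+j = +-cancelʳ-≡ 0 h (suc j) (trans (cong (_+_ h) (sym s≡0)) h+s≡)
  prependParts-complete G j (suc r) h t s t∈ j<h h+s≡ with m≤n⇒m<n∨m≡n j<h
  ... | inj₂ refl =
    ∈-++⁺ˡ (∈-map⁺ (suc j ∷_) (subst (λ u → t ∈ G u) (+-cancelˡ-≡ (suc j) s (suc r) h+s≡) t∈))
  ... | inj₁ 1+j<h =
    ∈-++⁺ʳ (map (suc j ∷_) (G (suc r)))
           (prependParts-complete G (suc j) r h t s t∈ 1+j<h (trans h+s≡ (+-suc (suc j) r)))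

  compositionsWithin-complete : ∀ f m c → m ≤ f → IsComposition⁰ m c → c ∈ compositionsWithin f m
  compositionsWithin-complete f       zero    []      _         _                  = here refl
  compositionsWithin-complete f       zero    (x ∷ c) _         (s≤s z≤n ∷ _ , ())
  compositionsWithin-complete (suc f) (suc r) []      _         (_ , ())
  compositionsWithin-complete (suc f) (suc r) (h ∷ t) (s≤s r≤f) (1≤h ∷ positive , sum≡) =
    prependParts-complete (compositionsWithin f) 0 r h t (sum t)
      (compositionsWithin-complete f (sum t) t (≤-trans sum[t]≤r r≤f) (positive , refl)) 1≤h sum≡
    where
    sum[t]≤r : sum t ≤ r
    sum[t]≤r = +-cancelˡ-≤ 1 (sum t) r (≤-trans (+-monoˡ-≤ (sum t) 1≤h) (≤-reflexive sum≡))

  prependParts-head : ∀ G j r c → c ∈ prependParts G j r → ∃₂ λ h t → c ≡ h ∷ t × suc j ≤ h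
  prependParts-head G j zero c c∈ with ∈-map⁻ (suc j ∷_) c∈
  ... | t , _ , refl = suc j , t , refl , ≤-refl
  prependParts-head G j (suc r) c c∈ with ∈-++⁻ (map (suc j ∷_) (G (suc r))) c∈
  ... | inj₁ c∈head with ∈-map⁻ (suc j ∷_) c∈head
  ...   | t , _ , refl = suc j , t , refl , ≤-refl
  prependParts-head G j (suc r) c c∈ | inj₂ c∈rest with prependParts-head G (suc j) r c c∈rest
  ... | h , t , c≡h∷t , 1+j<h = h , t , c≡h∷t , ≤-trans (n≤1+n (suc j)) 1+j<h

  prependParts-unique : ∀ G → (∀ s → Unique (G s)) → ∀ j r → Unique (prependParts G j r)
  prependParts-unique G G-unique j zero    = Unique.map⁺ ∷-injectiveʳ (G-unique 0)
  prependParts-unique G G-unique j (suc r) =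
    Unique.++⁺ (Unique.map⁺ ∷-injectiveʳ (G-unique (suc r))) (prependParts-unique G G-unique (suc j) r) disjoint
    where
    disjoint : ∀ {c} → ¬ (c ∈ map (suc j ∷_) (G (suc r)) × c ∈ prependParts G (suc j) r)
    disjoint (c∈head , c∈rest) with ∈-map⁻ (suc j ∷_) c∈head | prependParts-head G (suc j) r _ c∈rest
    ... | _ , _ , refl | _ , _ , refl , 1+j<1+j = <-irrefl refl 1+j<1+j

  compositionsWithin-unique : ∀ f m → Unique (compositionsWithin f m)
  compositionsWithin-unique f       zero    = [] ∷ []
  compositionsWithin-unique zero    (suc m) = []
  compositionsWithin-unique (suc f) (suc r) = prependParts-unique (compositionsWithin f) (compositionsWithin-unique f) 0 r

  compositions-unique : ∀ m → Unique (compositions m)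
  compositions-unique m = compositionsWithin-unique m m

  ∈compositions⇔IsComposition : ∀ {m} c → 1 ≤ m → c ∈ compositions m ⇔ IsComposition m c
  ∈compositions⇔IsComposition {m} c 1≤m = mk⇔
    (λ c∈ → Equivalence.to (IsComposition⁰⇔IsComposition c 1≤m) (compositionsWithin-sound m m c c∈))
    (λ isComp → compositionsWithin-complete m m c ≤-refl
                  (Equivalence.from (IsComposition⁰⇔IsComposition c 1≤m) isComp))

module CompositionSums where
  open PowerSeries
  open Compositions
  open FibonacciSeries
  open CatalanSeries using (alternatingCatalanSeries)
  open import Data.Nat using (zero; suc; s≤s)
  import Data.Nat.Properties as ℕₚ
  open import Data.Nat.Combinatorics using (_C_)
  open import Data.Integer using (_+_; _*_; -_; 0ℤ; _^_)
  open import Data.Integer.Properties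
    using (+-identityˡ; +-assoc; +-inverseˡ; *-identityˡ; *-zeroʳ; *-distribˡ-+; pos-*
          ; +-0-commutativeMonoid; +-0-abelianGroup)
  open import Data.Integer.Tactic.RingSolver using (solve-∀)
  open import Algebra.Bundles using (CommutativeMonoid)
  open import Data.List using ([]; _∷_; _++_; length)
  open import Data.List.Properties using (map-++)
  open import Data.List.Relation.Binary.Permutation.Propositional using (_↭_; ↭⇒↭ₛ)
  open import Data.List.Relation.Binary.Permutation.Propositional.Properties using (map⁺)
  open import Data.List.Relation.Binary.Permutation.Setoid.Properties using (foldr-commMonoid)
  open import Data.List.Relation.Binary.BagAndSetEquality using (∼bag⇒↭)
  open import Data.List.Membership.Propositional.Properties.WithK using (unique∧set⇒bag)
  open import Relation.Binary.PropositionalEquality using (refl; sym; trans; cong; cong₂; module ≡-Reasoning)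

  sumℤ-↭ : ∀ {xs ys} → xs ↭ ys → sumℤ xs ≡ sumℤ ys
  sumℤ-↭ p = foldr-commMonoid ℤ-+-0.setoid ℤ-+-0.isCommutativeMonoid (↭⇒↭ₛ p)
    where module ℤ-+-0 = CommutativeMonoid +-0-commutativeMonoid

  sumℤ-map-unique : ∀ {A : Set} (w : A → ℤ) {xs ys} → Unique xs → Unique ys →
                    (∀ {v} → (v ∈ xs) ⇔ (v ∈ ys)) → sumℤ (map w xs) ≡ sumℤ (map w ys)
  sumℤ-map-unique w xs-unique ys-unique same =
    sumℤ-↭ (map⁺ w (∼bag⇒↭ (unique∧set⇒bag xs-unique ys-unique same)))

  sumℤ-++ : ∀ xs ys → sumℤ (xs ++ ys) ≡ sumℤ xs + sumℤ ys
  sumℤ-++ []       ys = sym (+-identityˡ _)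
  sumℤ-++ (x ∷ xs) ys = trans (cong (_+_ x) (sumℤ-++ xs ys)) (sym (+-assoc x _ _))

  sumℤ-map-∷ : ∀ (w v : List ℕ → ℤ) a k cs → (∀ c → w (k ∷ c) ≡ a * v c) →
               sumℤ (map w (map (k ∷_) cs)) ≡ a * sumℤ (map v cs)
  sumℤ-map-∷ w v a k []       w≡ = sym (*-zeroʳ a)
  sumℤ-map-∷ w v a k (c ∷ cs) w≡ =
    trans (cong₂ _+_ (w≡ c) (sumℤ-map-∷ w v a k cs w≡)) (sym (*-distribˡ-+ a (v c) _))

  sumℤ-prependParts : ∀ G (α : Series) (w v : List ℕ → ℤ) → (∀ k c → w (suc k ∷ c) ≡ α k * v c) →
    ∀ j r → sumℤ (map w (prependParts G j r)) ≡ ((λ i → α (j ℕ.+ i)) ⊛ (λ s → sumℤ (map v (G s)))) r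
  sumℤ-prependParts G α w v w≡ j zero    =
    trans (sumℤ-map-∷ w v (α j) (suc j) (G 0) (w≡ j)) (cong (λ i → α i * _) (sym (ℕₚ.+-identityʳ j)))
  sumℤ-prependParts G α w v w≡ j (suc r) = begin
    sumℤ (map w (map (suc j ∷_) (G (suc r)) ++ prependParts G (suc j) r))
      ≡⟨ cong sumℤ (map-++ w (map (suc j ∷_) (G (suc r))) _) ⟩
    sumℤ (map w (map (suc j ∷_) (G (suc r))) ++ map w (prependParts G (suc j) r))
      ≡⟨ sumℤ-++ (map w (map (suc j ∷_) (G (suc r)))) _ ⟩
    sumℤ (map w (map (suc j ∷_) (G (suc r)))) + sumℤ (map w (prependParts G (suc j) r))
      ≡⟨ cong₂ _+_ (sumℤ-map-∷ w v (α j) (suc j) (G (suc r)) (w≡ j)) (sumℤ-prependParts G α w v w≡ (suc j) r) ⟩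
    α j * S (suc r) + ((λ i → α (suc j ℕ.+ i)) ⊛ S) r
      ≡⟨ cong₂ _+_ (cong (λ i → α i * S (suc r)) (sym (ℕₚ.+-identityʳ j)))
                   (⊛-cong {g = S} (λ i → cong α (sym (ℕₚ.+-suc j i))) (λ _ → refl) r) ⟩
    ((λ i → α (j ℕ.+ i)) ⊛ S) (suc r) ∎
    where
    open ≡-Reasoning
    S : Series
    S s = sumℤ (map v (G s))

  sumℤ-compositions-suc : ∀ (α : Series) (w v : List ℕ → ℤ) → (∀ k c → w (suc k ∷ c) ≡ α k * v c) →
    ∀ r → sumℤ (map w (compositions (suc r))) ≡ (α ⊛ λ s → sumℤ (map v (compositions s))) r
  sumℤ-compositions-suc α w v w≡ r =
    trans (sumℤ-prependParts (compositionsWithin r) α w v w≡ 0 r)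
          (⊛-cong-≤ r (λ _ _ → refl)
                      (λ s s≤r → cong (λ cs → sumℤ (map v cs)) (compositionsWithin-fuel r s s s≤r ℕₚ.≤-refl)))

  compositionWeight : ℕ → List ℕ → ℤ
  compositionWeight n c = -1ℤ ^ length c * + tailProd n c

  compositionSeries : ℕ → Series
  compositionSeries n m = sumℤ (map (compositionWeight n) (compositions m))

  -1*s*[a*t]≡-a*[s*t] : ∀ a t s → -1ℤ * s * + (a ℕ.* t) ≡ - + a * (s * + t)
  -1*s*[a*t]≡-a*[s*t] a t s = trans (cong (-1ℤ * s *_) (pos-* a t)) (regroup s (+ a) (+ t))
    where
    regroup : ∀ s a t → -1ℤ * s * (a * t) ≡ - a * (s * t)
    regroup = solve-∀

  fibonacci⊛compositionSeries : ∀ n → fibonacciSeries n ⊛ compositionSeries n ≋ 𝟙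
  fibonacci⊛compositionSeries n zero    = refl
  fibonacci⊛compositionSeries n (suc r) = begin
    F 0 * T (suc r) + (tail F ⊛ T) r    ≡⟨ cong (_+ (tail F ⊛ T) r) (*-identityˡ (T (suc r))) ⟩
    T (suc r) + (tail F ⊛ T) r          ≡⟨ cong (_+ (tail F ⊛ T) r) (sumℤ-compositions-suc (⊖ tail F) w w w-∷ r) ⟩
    (⊖ tail F ⊛ T) r + (tail F ⊛ T) r   ≡⟨ cong (_+ (tail F ⊛ T) r) (⊖-⊛ (tail F) T r) ⟩
    - (tail F ⊛ T) r + (tail F ⊛ T) r   ≡⟨ +-inverseˡ ((tail F ⊛ T) r) ⟩
    0ℤ                                  ∎
    where
    open ≡-Reasoning
    F = fibonacciSeries n
    T = compositionSeries n
    w = compositionWeight n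
    w-∷ : ∀ k c → w (suc k ∷ c) ≡ (⊖ tail F) k * w c
    w-∷ k c = -1*s*[a*t]≡-a*[s*t] ((n ∸ suc k) C suc k) (tailProd n c) (-1ℤ ^ length c)

  sumℤ-term : ∀ n r → sumℤ (map (term (suc n)) (compositions (suc r)))
                    ≡ (⊖ fibonacciSeries n ⊛ compositionSeries (suc n)) r
  sumℤ-term n r =
    sumℤ-compositions-suc (⊖ fibonacciSeries n) (term (suc n)) (compositionWeight (suc n)) term-∷ r
    where
    term-∷ : ∀ k c → term (suc n) (suc k ∷ c) ≡ (⊖ fibonacciSeries n) k * compositionWeight (suc n) c
    term-∷ k c = -1*s*[a*t]≡-a*[s*t] ((n ∸ k) C k) (tailProd (suc n) c) (-1ℤ ^ length c)

  ⊖fibonacci⊛compositionSeries : ∀ n r → r ≤ n →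
    (⊖ fibonacciSeries n ⊛ compositionSeries (suc n)) r ≡ alternatingCatalanSeries (suc r)
  ⊖fibonacci⊛compositionSeries n r r≤n = begin
    (⊖ F n ⊛ T) r                      ≡⟨ +-identityˡ _ ⟨
    (shift (⊖ F n) ⊛ T) (suc r)        ≡⟨ ⊛-cong-≤ (suc r) shift⊖F≡g⊛F (λ _ _ → refl) ⟩
    ((g ⊛ F (suc n)) ⊛ T) (suc r)      ≡⟨ ⊛-assoc g (F (suc n)) T (suc r) ⟩
    (g ⊛ (F (suc n) ⊛ T)) (suc r)      ≡⟨ ⊛-cong {g} (λ _ → refl) (fibonacci⊛compositionSeries (suc n)) (suc r) ⟩
    (g ⊛ 𝟙) (suc r)                    ≡⟨ ⊛-comm g 𝟙 (suc r) ⟩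
    (𝟙 ⊛ g) (suc r)                    ≡⟨ 𝟙-⊛ g (suc r) ⟩
    g (suc r)                          ∎
    where
    open ≡-Reasoning
    open import Algebra.Properties.AbelianGroup +-0-abelianGroup using (inverseˡ-unique)
    F = fibonacciSeries
    T = compositionSeries (suc n)
    g = alternatingCatalanSeries
    shift-⊖ : ∀ f → shift (⊖ f) ≋ ⊖ shift f
    shift-⊖ f zero    = refl
    shift-⊖ f (suc i) = refl
    shift⊖F≡g⊛F : shift (⊖ F n) ≡[≤ suc r ] g ⊛ F (suc n)
    shift⊖F≡g⊛F i i≤1+r = begin
      shift (⊖ F n) i       ≡⟨ shift-⊖ (F n) i ⟩
      - shift (F n) i       ≡⟨ cong -_ (X-⊛ (F n) i) ⟨
      - (X ⊛ F n) i         ≡⟨ inverseˡ-unique _ _ (fibonacciRemainder-vanishes n i (ℕₚ.≤-trans i≤1+r (s≤s r≤n))) ⟨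
      (g ⊛ F (suc n)) i     ∎

mainTheorem4 : (m n : ℕ) → 1 ≤ m → m ≤ n →
    (comps : List (List ℕ)) → Unique comps →
    ((c : List ℕ) → (c ∈ comps) ⇔ IsComposition m c) →
    sumℤ (map (term n) comps) ≡ (-1ℤ ℤ.^ m) ℤ.* (+ catalan (m ∸ 1))
mainTheorem4 (ℕ.suc r) (ℕ.suc n) 1≤m (ℕ.s≤s r≤n) comps comps-unique comps⇔ = begin
  sumℤ (map (term (ℕ.suc n)) comps)
    ≡⟨ sumℤ-map-unique (term (ℕ.suc n)) comps-unique (compositions-unique (ℕ.suc r)) same ⟩
  sumℤ (map (term (ℕ.suc n)) (compositions (ℕ.suc r)))
    ≡⟨ sumℤ-term n r ⟩
  (⊖ fibonacciSeries n ⊛ compositionSeries (ℕ.suc n)) r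
    ≡⟨ ⊖fibonacci⊛compositionSeries n r r≤n ⟩
  alternatingCatalanSeries (ℕ.suc r) ∎
  where
  open import Relation.Binary.PropositionalEquality using (module ≡-Reasoning)
  import Function.Properties.Equivalence as ⇔
  open ≡-Reasoning
  open PowerSeries using (⊖_; _⊛_)
  open Compositions using (compositions; compositions-unique; ∈compositions⇔IsComposition)
  open FibonacciSeries using (fibonacciSeries)
  open CatalanSeries using (alternatingCatalanSeries)
  open CompositionSums
  same : ∀ {c} → (c ∈ comps) ⇔ (c ∈ compositions (ℕ.suc r))
  same {c} = ⇔.trans (comps⇔ c) (⇔.sym (∈compositions⇔IsComposition c 1≤m))
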